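{- Let $D_\lambda\in\mathfrak{D}_n$, let $g$ be a linear extension of $D_\lambda$, let $1\le k\le n$, and let $C$ be a chain of $D_\lambda$ with $g^{ -1}(i)\in C$. Then in $q_{k-1}(g)$ the chain $C$ contains the label $i$ if $i>k$, and the label $k+1-i$ if $i\le k$.
   Context: For a finite poset $X$ with $|X|=N$, a linear extension is a bijection $g:X\to\{1,\ldots,N\}$ with $g(a)<g(b)$ whenever $a<_X b$. For $1\le i\le N-1$ the Bender–Knuth involution $t_i$ swaps labels $i$ and $i+1$ if $g^{ -1}(i)$, $g^{ -1}(i+1)$ are incomparable, and does nothing otherwise. Products denote composition, rightmost first. $q_0=\mathrm{id}$ and $q_i=t_1(t_2t_1)\cdots(t_it_{i-1}\cdots t_1)$ for $i\ge1$ (evacuation). $C_m$ is the $m$-element chain, $+$ is disjoint union; for $n>1$, $\mathfrak{D}_n$ is the set of posets $C_{\lambda_1}+\cdots+C_{\lambda_\ell}$ with $\lambda\vdash n$, $\ell>1$; $\mathfrak{D}_1=\{C_1\}$. -}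

module Defs where

open import Data.Nat using (ℕ; zero; suc; _+_; _∸_; _≤_; _<_; _≥_; _≟_; _≤?_)
open import Data.Nat.Properties using ()
open import Data.Fin using (Fin; toℕ)
open import Data.Fin.Properties using (any?)
open import Data.List using (List; length; lookup)
open import Data.Nat.ListAction using (sum)
open import Data.List.Relation.Unary.All using (All)
open import Data.List.Relation.Unary.Linked using (Linked)
open import Data.Product using (Σ; ∃; _×_; _,_; proj₁; proj₂)
open import Data.Sum using (_⊎_; inj₁; inj₂)
open import Relation.Nullary using (¬_; Dec; yes; no; ¬?)
open import Relation.Nullary.Decidable using (_×-dec_; _⊎-dec_)
open import Relation.Binary.PropositionalEquality using (_≡_)
open import Function using (_∘_; id)

record IsPartition (n : ℕ) (λs : List ℕ) : Set where
  field
    positive    : All (1 ≤_) λs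
    decreasing  : Linked _≥_ λs
    sums        : sum λs ≡ n

-- λ is the index of a poset D_λ in 𝔇_n:
--   n > 1 : λ ⊢ n with more than one part;  n = 1 : D_1 = {C_1}, i.e. λ = (1).
InFrakD : ℕ → List ℕ → Set
InFrakD n λs = IsPartition n λs × (n ≡ 1 ⊎ (1 < n × 1 < length λs))

-- Elements of D_λ = C_{λ_1} + ... + C_{λ_ℓ}: a chain index j and a position p
-- in the chain C_{λ_j} (positions 0 < 1 < ... < λ_j - 1).
Elt : List ℕ → Set
Elt λs = Σ (Fin (length λs)) (λ j → Fin (lookup λs j))

Le : (λs : List ℕ) → Elt λs → Elt λs → Set
Le λs (j , p) (j' , p') = (j ≡ j') × (toℕ p ≤ toℕ p')

Comparable : (λs : List ℕ) → Elt λs → Elt λs → Set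
Comparable λs x y = Le λs x y ⊎ Le λs y x

comparable? : (λs : List ℕ) (x y : Elt λs) → Dec (Comparable λs x y)
comparable? λs (j , p) (j' , p') =
  ((j Data.Fin.≟ j') ×-dec (toℕ p ≤? toℕ p')) ⊎-dec ((j' Data.Fin.≟ j) ×-dec (toℕ p' ≤? toℕ p))

anyElt? : (λs : List ℕ) {P : Elt λs → Set} → ((x : Elt λs) → Dec (P x)) → Dec (∃ P)
anyElt? λs {P} P? with any? {P = λ j → ∃ λ (p : Fin (lookup λs j)) → P (j , p)} (λ j → any? (λ p → P? (j , p)))
... | yes (j , p , q) = yes ((j , p) , q)
... | no ¬e = no λ { ((j , p) , q) → ¬e (j , p , q) }

Labelling : List ℕ → Set
Labelling λs = Elt λs → ℕ

record IsLinearExtension (n : ℕ) (λs : List ℕ) (g : Labelling λs) : Set where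
  field
    inRange    : ∀ x → 1 ≤ g x × g x ≤ n
    injective  : ∀ x y → g x ≡ g y → x ≡ y
    surjective : ∀ m → 1 ≤ m → m ≤ n → ∃ λ x → g x ≡ m
    monotone   : ∀ j (p p' : Fin (lookup λs j)) → toℕ p < toℕ p' → g (j , p) < g (j , p')

IncompLabels : (λs : List ℕ) → Labelling λs → Elt λs → ℕ → Set
IncompLabels λs g x b = ∃ λ y → (g y ≡ b) × ¬ Comparable λs x y

incompLabels? : (λs : List ℕ) (g : Labelling λs) (x : Elt λs) (b : ℕ) → Dec (IncompLabels λs g x b)
incompLabels? λs g x b = anyElt? λs (λ y → (g y ≟ b) ×-dec ¬? (comparable? λs x y))

-- Bender–Knuth involution t_i: swaps labels i and i+1 if their preimages are
-- incomparable, otherwise does nothing.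
t : (λs : List ℕ) → ℕ → Labelling λs → Labelling λs
t λs i g x = tAt (g x ≟ i) (g x ≟ suc i) (incompLabels? λs g x (suc i)) (incompLabels? λs g x i)
  where
  tAt : Dec (g x ≡ i) → Dec (g x ≡ suc i) → Dec (IncompLabels λs g x (suc i)) → Dec (IncompLabels λs g x i) → ℕ
  tAt (yes _) _       (yes _) _       = suc i
  tAt (yes _) _       (no _)  _       = i
  tAt (no _)  (yes _) _       (yes _) = i
  tAt (no _)  (yes _) _       (no _)  = suc i
  tAt (no _)  (no _)  _       _       = g x

seg : (λs : List ℕ) → ℕ → Labelling λs → Labelling λs
seg λs zero    = id
seg λs (suc i) = t λs (suc i) ∘ seg λs i

-- evacuation q_0 = id, q_i = t_1 (t_2 t_1) ⋯ (t_i ⋯ t_1) = q_{i-1} ∘ (t_i ⋯ t_1)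
q : (λs : List ℕ) → ℕ → Labelling λs → Labelling λs
q λs zero    = id
q λs (suc i) = q λs i ∘ seg λs (suc i)

{-# OPTIONS --safe #-}
-- In a disjoint union of chains two elements are comparable exactly when they lie on
-- the same chain. Hence, for a bijective labelling g, the involution t_i either swaps
-- the labels i and i+1 (when they lie on different chains) or fixes g (when they lie
-- on the same chain); in both cases the chain carrying label m in t_i g is the chain
-- carrying label s_i(m) in g, where s_i is the transposition (i i+1). Composing, the
-- chains of t_j ⋯ t_1 g are those of g relabelled by the cycle s_1 ⋯ s_j, which sends
-- m ↦ m+1 on {1,…,j} and j+1 ↦ 1, and the chains of q_j g are those of g relabelled
-- by the product of these cycles, which is the reversal m ↦ j+2-m of {1,…,j+1}.
module Submission where

open import Defs
open import Data.Nat using (ℕ; zero; suc; _+_; _∸_; _≤_; _<_; _≟_; z≤n; s≤s)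
open import Data.Nat.Properties
  using (≤-trans; <-trans; n≤1+n; n<1+n; <⇒≢; >⇒≢; ≤-pred; m<1+n⇒m<n∨m≡n; +-suc; +-identityʳ;
         m≤n+m; +-comm; +-∸-comm; m∸n+n≡m; suc-injective)
open import Data.Fin using (Fin)
open import Data.List using (List; length; lookup)
open import Data.Product using (∃; _×_; _,_; proj₁; proj₂)
open import Data.Sum using (inj₁; inj₂)
import Data.Sum as Sum
open import Data.Empty using (⊥-elim)
open import Function using (_∘_; id)
open import Relation.Nullary using (¬_; yes; no)
open import Relation.Binary.PropositionalEquality
  using (_≡_; _≢_; refl; sym; trans; cong; subst; _≗_; module ≡-Reasoning)
open ≡-Reasoning

swapAdjacent : ℕ → ℕ → ℕ
swapAdjacent i m with m ≟ i | m ≟ suc i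
... | yes _ | _     = suc i
... | no _  | yes _ = i
... | no _  | no _  = m

swapAdjacent-≡ : ∀ i → swapAdjacent i i ≡ suc i
swapAdjacent-≡ i with i ≟ i
... | yes _ = refl
... | no i≢i = ⊥-elim (i≢i refl)

swapAdjacent-suc : ∀ i → swapAdjacent i (suc i) ≡ i
swapAdjacent-suc i with suc i ≟ i | suc i ≟ suc i
... | yes 1+i≡i | _ = ⊥-elim (<⇒≢ (n<1+n i) (sym 1+i≡i))
... | no _ | yes _ = refl
... | no _ | no 1+i≢1+i = ⊥-elim (1+i≢1+i refl)

swapAdjacent-≢ : ∀ {i m} → m ≢ i → m ≢ suc i → swapAdjacent i m ≡ m
swapAdjacent-≢ {i} {m} m≢i m≢1+i with m ≟ i | m ≟ suc i
... | yes m≡i | _ = ⊥-elim (m≢i m≡i)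
... | no _ | yes m≡1+i = ⊥-elim (m≢1+i m≡1+i)
... | no _ | no _ = refl

swapAdjacent-involutive : ∀ i m → swapAdjacent i (swapAdjacent i m) ≡ m
swapAdjacent-involutive i m with m ≟ i | m ≟ suc i
... | yes refl | _ = swapAdjacent-suc i
... | no _ | yes refl = swapAdjacent-≡ i
... | no m≢i | no m≢1+i = swapAdjacent-≢ m≢i m≢1+i

swapAdjacent-inRange : ∀ {n i m} → 1 ≤ i → i < n → 1 ≤ m → m ≤ n →
                       1 ≤ swapAdjacent i m × swapAdjacent i m ≤ n
swapAdjacent-inRange {n} {i} {m} 1≤i i<n 1≤m m≤n with m ≟ i | m ≟ suc i
... | yes _ | _     = s≤s z≤n , i<n
... | no _  | yes _ = 1≤i , ≤-trans (n≤1+n i) i<n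
... | no _  | no _  = 1≤m , m≤n

rotateUpTo : ℕ → ℕ → ℕ
rotateUpTo zero    = id
rotateUpTo (suc j) = rotateUpTo j ∘ swapAdjacent (suc j)

reverseUpTo : ℕ → ℕ → ℕ
reverseUpTo zero    = id
reverseUpTo (suc j) = rotateUpTo (suc j) ∘ reverseUpTo j

rotateUpTo-above : ∀ {j m} → suc j < m → rotateUpTo j m ≡ m
rotateUpTo-above {zero} _ = refl
rotateUpTo-above {suc j} {m} 2+j<m = begin
  rotateUpTo j (swapAdjacent (suc j) m)
    ≡⟨ cong (rotateUpTo j) (swapAdjacent-≢ (>⇒≢ 1+j<m) (>⇒≢ 2+j<m)) ⟩
  rotateUpTo j m
    ≡⟨ rotateUpTo-above 1+j<m ⟩
  m ∎
  where 1+j<m = <-trans (n<1+n (suc j)) 2+j<m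

rotateUpTo-top : ∀ j → rotateUpTo j (suc j) ≡ 1
rotateUpTo-top zero    = refl
rotateUpTo-top (suc j) = trans (cong (rotateUpTo j) (swapAdjacent-suc (suc j))) (rotateUpTo-top j)

rotateUpTo-below : ∀ {j m} → m < j → rotateUpTo j (suc m) ≡ suc (suc m)
rotateUpTo-below {suc j} {m} m<1+j with m<1+n⇒m<n∨m≡n m<1+j
... | inj₂ refl = begin
  rotateUpTo m (swapAdjacent (suc m) (suc m)) ≡⟨ cong (rotateUpTo m) (swapAdjacent-≡ (suc m)) ⟩
  rotateUpTo m (suc (suc m))                   ≡⟨ rotateUpTo-above (n<1+n (suc m)) ⟩
  suc (suc m)                                  ∎
... | inj₁ m<j = begin
  rotateUpTo j (swapAdjacent (suc j) (suc m))
    ≡⟨ cong (rotateUpTo j) (swapAdjacent-≢ (<⇒≢ (s≤s m<j)) (<⇒≢ (s≤s (<-trans m<j (n<1+n j))))) ⟩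
  rotateUpTo j (suc m)
    ≡⟨ rotateUpTo-below m<j ⟩
  suc (suc m) ∎

reverseUpTo-above : ∀ {j m} → suc j < m → reverseUpTo j m ≡ m
reverseUpTo-above {zero} _ = refl
reverseUpTo-above {suc j} {m} 2+j<m = begin
  rotateUpTo (suc j) (reverseUpTo j m)
    ≡⟨ cong (rotateUpTo (suc j)) (reverseUpTo-above (<-trans (n<1+n (suc j)) 2+j<m)) ⟩
  rotateUpTo (suc j) m
    ≡⟨ rotateUpTo-above 2+j<m ⟩
  m ∎

reverseUpTo-inside : ∀ {j} a b → a + b ≡ j → reverseUpTo j (suc a) ≡ suc b
reverseUpTo-inside {zero} zero zero refl = refl
reverseUpTo-inside {suc j} a zero a+0≡1+j = begin
  rotateUpTo (suc j) (reverseUpTo j (suc a))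
    ≡⟨ cong (rotateUpTo (suc j) ∘ reverseUpTo j ∘ suc) (trans (sym (+-identityʳ a)) a+0≡1+j) ⟩
  rotateUpTo (suc j) (reverseUpTo j (suc (suc j)))
    ≡⟨ cong (rotateUpTo (suc j)) (reverseUpTo-above (n<1+n (suc j))) ⟩
  rotateUpTo (suc j) (suc (suc j))
    ≡⟨ rotateUpTo-top (suc j) ⟩
  1 ∎
reverseUpTo-inside {suc j} a (suc b) a+1+b≡1+j = begin
  rotateUpTo (suc j) (reverseUpTo j (suc a))
    ≡⟨ cong (rotateUpTo (suc j)) (reverseUpTo-inside a b a+b≡j) ⟩
  rotateUpTo (suc j) (suc b)
    ≡⟨ rotateUpTo-below (s≤s (subst (b ≤_) a+b≡j (m≤n+m b a))) ⟩
  suc (suc b) ∎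
  where a+b≡j = suc-injective (trans (sym (+-suc a b)) a+1+b≡1+j)

reverseUpTo-flip : ∀ {j m} → 1 ≤ m → m ≤ suc j → reverseUpTo j (suc j + 1 ∸ m) ≡ m
reverseUpTo-flip {j} {suc a} _ 1+a≤1+j = begin
  reverseUpTo j ((j + 1) ∸ a) ≡⟨ cong (reverseUpTo j) (trans (+-∸-comm 1 a≤j) (+-comm (j ∸ a) 1)) ⟩
  reverseUpTo j (suc (j ∸ a)) ≡⟨ reverseUpTo-inside (j ∸ a) a (m∸n+n≡m a≤j) ⟩
  suc a                       ∎
  where a≤j = ≤-pred 1+a≤1+j

module _ {λs : List ℕ} where

  ChainHas : Labelling λs → Fin (length λs) → ℕ → Set
  ChainHas g C m = ∃ λ x → proj₁ x ≡ C × g x ≡ m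

  chainHas⇒label : ∀ {g C m} → ChainHas g C m → ∃ λ (p : Fin (lookup λs C)) → g (C , p) ≡ m
  chainHas⇒label ((_ , p) , refl , gx≡m) = p , gx≡m

  RelabelsChains : (ℕ → ℕ) → Labelling λs → Labelling λs → Set
  RelabelsChains π g h = ∀ C m → ChainHas g C (π m) → ChainHas h C m

  relabelsChains-id : ∀ {g} → RelabelsChains id g g
  relabelsChains-id _ _ = id

  relabelsChains-∘ : ∀ {π ρ g h k} → RelabelsChains π g h → RelabelsChains ρ h k →
                     RelabelsChains (π ∘ ρ) g k
  relabelsChains-∘ {ρ = ρ} g→h h→k C m = h→k C m ∘ g→h C (ρ m)

  relabelsChains-resp-≗ : ∀ {π g h h′} → h ≗ h′ → RelabelsChains π g h′ → RelabelsChains π g h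
  relabelsChains-resp-≗ h≗h′ g→h′ C m C∋πm =
    let x , x∈C , h′x≡m = g→h′ C m C∋πm in x , x∈C , trans (h≗h′ x) h′x≡m

  relabelsChains-swapAdjacent : ∀ {i g} → RelabelsChains (swapAdjacent i) g (swapAdjacent i ∘ g)
  relabelsChains-swapAdjacent {i} _ m (x , x∈C , gx≡sm) =
    x , x∈C , trans (cong (swapAdjacent i) gx≡sm) (swapAdjacent-involutive i m)

  comparable⇒sameChain : ∀ {x y} → Comparable λs x y → proj₁ x ≡ proj₁ y
  comparable⇒sameChain (inj₁ (same , _)) = same
  comparable⇒sameChain (inj₂ (same , _)) = sym same

  record IsBijectionOnto (n : ℕ) (g : Labelling λs) : Set where
    field
      injective  : ∀ x y → g x ≡ g y → x ≡ y
      surjective : ∀ m → 1 ≤ m → m ≤ n → ∃ λ x → g x ≡ m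

  isBijectionOnto-resp-≗ : ∀ {n g h} → h ≗ g → IsBijectionOnto n g → IsBijectionOnto n h
  isBijectionOnto-resp-≗ {g = g} {h} h≗g bij = record
    { injective  = λ x y hx≡hy → injective x y (trans (sym (h≗g x)) (trans hx≡hy (h≗g y)))
    ; surjective = λ m 1≤m m≤n → let x , gx≡m = surjective m 1≤m m≤n in x , trans (h≗g x) gx≡m
    }
    where open IsBijectionOnto bij

  isBijectionOnto-swapAdjacent : ∀ {n i g} → 1 ≤ i → i < n →
                                 IsBijectionOnto n g → IsBijectionOnto n (swapAdjacent i ∘ g)
  isBijectionOnto-swapAdjacent {i = i} {g} 1≤i i<n bij = record
    { injective  = λ x y sgx≡sgy → injective x y (begin
        g x                                   ≡⟨ sym (swapAdjacent-involutive i (g x)) ⟩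
        swapAdjacent i (swapAdjacent i (g x)) ≡⟨ cong (swapAdjacent i) sgx≡sgy ⟩
        swapAdjacent i (swapAdjacent i (g y)) ≡⟨ swapAdjacent-involutive i (g y) ⟩
        g y                                   ∎)
    ; surjective = λ m 1≤m m≤n →
        let 1≤sm , sm≤n = swapAdjacent-inRange 1≤i i<n 1≤m m≤n
            x , gx≡sm   = surjective (swapAdjacent i m) 1≤sm sm≤n
        in  x , trans (cong (swapAdjacent i) gx≡sm) (swapAdjacent-involutive i m)
    }
    where open IsBijectionOnto bij

  module _ {n : ℕ} {g : Labelling λs} (bij : IsBijectionOnto n g) where
    open IsBijectionOnto bij

    chainHas-unique : ∀ {C m y} → ChainHas g C m → g y ≡ m → proj₁ y ≡ C
    chainHas-unique {y = y} (x , x∈C , gx≡m) gy≡m =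
      trans (cong proj₁ (injective y x (trans gy≡m (sym gx≡m)))) x∈C

    module _ {i : ℕ} {a b : Elt λs} (ga≡i : g a ≡ i) (gb≡1+i : g b ≡ suc i) where

      t-incomparable : ¬ Comparable λs a b → ∀ x → t λs i g x ≡ swapAdjacent i (g x)
      -- The `with` also abstracts the tests inside `swapAdjacent i (g x)`, so three cases are refl.
      t-incomparable a≁b x
        with g x ≟ i | g x ≟ suc i | incompLabels? λs g x (suc i) | incompLabels? λs g x i
      ... | yes _ | _ | yes _ | _ = refl
      ... | yes gx≡i | _ | no ¬x≁b | _ with refl ← injective x a (trans gx≡i (sym ga≡i)) =
        ⊥-elim (¬x≁b (b , gb≡1+i , a≁b))
      ... | no _ | yes _ | _ | yes _ = refl
      ... | no _ | yes gx≡1+i | _ | no ¬x≁a with refl ← injective x b (trans gx≡1+i (sym gb≡1+i)) =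
        ⊥-elim (¬x≁a (a , ga≡i , a≁b ∘ Sum.swap))
      ... | no _ | no _ | _ | _ = refl

      t-comparable : Comparable λs a b → ∀ x → t λs i g x ≡ g x
      t-comparable a∼b x
        with g x ≟ i | g x ≟ suc i | incompLabels? λs g x (suc i) | incompLabels? λs g x i
      ... | yes gx≡i | _ | yes (y , gy≡1+i , x≁y) | _
        with refl ← injective x a (trans gx≡i (sym ga≡i))
           | refl ← injective y b (trans gy≡1+i (sym gb≡1+i)) =
        ⊥-elim (x≁y a∼b)
      ... | yes gx≡i | _ | no _ | _ = sym gx≡i
      ... | no _ | yes gx≡1+i | _ | yes (y , gy≡i , x≁y)
        with refl ← injective x b (trans gx≡1+i (sym gb≡1+i))
           | refl ← injective y a (trans gy≡i (sym ga≡i)) =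
        ⊥-elim (x≁y (Sum.swap a∼b))
      ... | no _ | yes gx≡1+i | _ | no _ = sym gx≡1+i
      ... | no _ | no _ | _ | _ = refl

      relabelsChains-sameChain : proj₁ a ≡ proj₁ b → RelabelsChains (swapAdjacent i) g g
      relabelsChains-sameChain a~b C m C∋sm with m ≟ i | m ≟ suc i
      ... | yes refl | _ = a , trans a~b (chainHas-unique C∋sm gb≡1+i) , ga≡i
      ... | no _ | yes refl = b , trans (sym a~b) (chainHas-unique C∋sm ga≡i) , gb≡1+i
      ... | no _ | no _ = C∋sm

    t-relabelsChains : ∀ {i} → 1 ≤ i → i < n →
                       IsBijectionOnto n (t λs i g) × RelabelsChains (swapAdjacent i) g (t λs i g)
    t-relabelsChains {i} 1≤i i<n
      with a , ga≡i   ← surjective i 1≤i (≤-trans (n≤1+n i) i<n)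
         | b , gb≡1+i ← surjective (suc i) (s≤s z≤n) i<n
      with comparable? λs a b
    ... | yes a∼b =
      isBijectionOnto-resp-≗ t≗g bij ,
      relabelsChains-resp-≗ t≗g (relabelsChains-sameChain ga≡i gb≡1+i (comparable⇒sameChain a∼b))
      where t≗g = t-comparable ga≡i gb≡1+i a∼b
    ... | no a≁b =
      isBijectionOnto-resp-≗ t≗sg (isBijectionOnto-swapAdjacent 1≤i i<n bij) ,
      relabelsChains-resp-≗ t≗sg relabelsChains-swapAdjacent
      where t≗sg = t-incomparable ga≡i gb≡1+i a≁b

  seg-relabelsChains : ∀ {n j g} → j < n → IsBijectionOnto n g →
                       IsBijectionOnto n (seg λs j g) × RelabelsChains (rotateUpTo j) g (seg λs j g)
  seg-relabelsChains {j = zero} _ bij = bij , relabelsChains-id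
  seg-relabelsChains {j = suc j} 1+j<n bij =
    let bij′ , g→seg = seg-relabelsChains (<-trans (n<1+n j) 1+j<n) bij
        bij″ , seg→t = t-relabelsChains bij′ (s≤s z≤n) 1+j<n
    in  bij″ , relabelsChains-∘ g→seg seg→t

  q-relabelsChains : ∀ {n j g} → j < n → IsBijectionOnto n g →
                     IsBijectionOnto n (q λs j g) × RelabelsChains (reverseUpTo j) g (q λs j g)
  q-relabelsChains {j = zero} _ bij = bij , relabelsChains-id
  q-relabelsChains {j = suc j} 1+j<n bij =
    let bij′ , g→seg = seg-relabelsChains 1+j<n bij
        bij″ , seg→q = q-relabelsChains (<-trans (n<1+n j) 1+j<n) bij′
    in  bij″ , relabelsChains-∘ g→seg seg→q

lemma3p2 : (n : ℕ) (λs : List ℕ) → InFrakD n λs →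
    (g : Labelling λs) → IsLinearExtension n λs g →
    (k : ℕ) → 1 ≤ k → k ≤ n →
    (i : ℕ) (C : Fin (length λs)) → (∃ λ (p : Fin (lookup λs C)) → g (C , p) ≡ i) →
    (k < i → ∃ λ (p : Fin (lookup λs C)) → q λs (k ∸ 1) g (C , p) ≡ i)
    × (i ≤ k → ∃ λ (p : Fin (lookup λs C)) → q λs (k ∸ 1) g (C , p) ≡ k + 1 ∸ i)
lemma3p2 n λs _ g linExt (suc j) (s≤s z≤n) 1+j≤n i C (p , gp≡i) =
  (λ 1+j<i → relabelled i (reverseUpTo-above 1+j<i)) ,
  (λ i≤1+j → relabelled (suc j + 1 ∸ i) (reverseUpTo-flip 1≤i i≤1+j))
  where
  open IsLinearExtension linExt
  g→q : RelabelsChains {λs} (reverseUpTo j) g (q λs j g)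
  g→q = proj₂ (q-relabelsChains 1+j≤n bij)
    where
    bij : IsBijectionOnto n g
    bij = record { injective = injective ; surjective = surjective }
  1≤i : 1 ≤ i
  1≤i = subst (1 ≤_) gp≡i (proj₁ (inRange (C , p)))
  relabelled : ∀ m → reverseUpTo j m ≡ i → ∃ λ (p′ : Fin (lookup λs C)) → q λs j g (C , p′) ≡ m
  relabelled m rev[m]≡i = chainHas⇒label {λs} (g→q C m ((C , p) , refl , trans gp≡i (sym rev[m]≡i)))
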